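{- For all $n\ge 1$, $L(n)\subseteq B(n)$. In particular, $\ell(n)=|L(n)|\le F_n$ for all $n\ge 1$, where $F_n$ is the $n$-th Fibonacci number ($F_1=F_2=1$, $F_n=F_{n-1}+F_{n-2}$).
   Context: Fix a field $K$. Let $R=K[x_1,\dots,x_m]$ be a polynomial ring (any $m\ge 0$) with standard grading $\deg x_i=1$, and let $I$ be a homogeneous ideal with $R/I$ of Krull dimension zero. The Hilbert function is $H_{R/I}(t)=\dim_K (R/I)_t$; if $s$ is the largest integer with $H_{R/I}(s)\neq 0$, the $h$-vector of $R/I$ is $(H_{R/I}(0),H_{R/I}(1),\dots,H_{R/I}(s))$. An $h$-vector is any integer vector arising this way. For $n\ge1$, $L(n)$ is the set of $h$-vectors whose entries sum to $n$, and $\ell(n)=|L(n)|$. The sets $B(n)$ are defined recursively: $B(1)=\{(1)\}$, $B(2)=\{(1,1)\}$, and for $n\ge 3$, $B(n)=C(n)\cup D(n)$ with $C(n)=\{(1,t_1,\dots,t_s,1) : (1,t_1,\dots,t_s)\in B(n-1)\}$ and $D(n)=\{(1,t_1,\dots,t_{s-1},t_s+1) : (1,t_1,\dots,t_s)\in B(n-1),\ t_{s-1}>1 \text{ or } s=1\}$. -}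

module Defs where

open import Level using (Level; _⊔_) renaming (suc to lsuc)
open import Algebra.Bundles using (CommutativeRing)
open import Data.Bool using (Bool; true; false)
open import Data.Nat using (ℕ; zero; suc; _≤_; _<ᵇ_) renaming (_≟_ to _≟ℕ_; _+_ to _+ℕ_)
open import Data.Nat.ListAction using (sum)
open import Data.Fin using (Fin; toℕ)
open import Data.Product using (Σ; _×_; _,_)
open import Data.List using (List; []; _∷_; _++_; map; concatMap; length; filterᵇ; _∷ʳ_)
import Data.List as L
open import Data.Vec using (Vec; zipWith; toList)
import Data.Vec as V
open import Data.Vec.Properties using (≡-dec)
open import Relation.Nullary using (¬_; yes; no)
open import Relation.Binary.PropositionalEquality using (_≡_; _≢_)

record Field (c ℓ : Level) : Set (lsuc (c ⊔ ℓ)) where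
  field
    commutativeRing : CommutativeRing c ℓ
  open CommutativeRing commutativeRing public
  field
    0≉1     : ¬ (0# ≈ 1#)
    inverse : ∀ x → ¬ (x ≈ 0#) → Σ Carrier λ y → x * y ≈ 1#

module Poly {c ℓ : Level} (K : Field c ℓ) where
  open Field K

  Monomial : ℕ → Set
  Monomial m = Vec ℕ m

  deg : ∀ {m} → Monomial m → ℕ
  deg α = sum (toList α)

  -- a polynomial is a formal finite sum of terms a·x^α
  -- (equality of polynomials is coefficientwise, see _≈ₚ_)
  Pol : ℕ → Set c
  Pol m = List (Carrier × Monomial m)

  coeff : ∀ {m} → Pol m → Monomial m → Carrier
  coeff [] α = 0#
  coeff ((a , β) ∷ p) α with ≡-dec _≟ℕ_ β α
  ... | yes _ = a + coeff p α
  ... | no  _ = coeff p α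

  _≈ₚ_ : ∀ {m} → Pol m → Pol m → Set ℓ
  p ≈ₚ q = ∀ α → coeff p α ≈ coeff q α

  0ₚ : ∀ {m} → Pol m
  0ₚ = []

  _+ₚ_ : ∀ {m} → Pol m → Pol m → Pol m
  p +ₚ q = p ++ q

  -ₚ_ : ∀ {m} → Pol m → Pol m
  -ₚ p = map (λ { (a , β) → (- a , β) }) p

  _*ₚ_ : ∀ {m} → Pol m → Pol m → Pol m
  p *ₚ q = concatMap (λ { (a , β) → map (λ { (b , γ) → (a * b , zipWith _+ℕ_ β γ) }) q }) p

  _·ₚ_ : ∀ {m} → Carrier → Pol m → Pol m
  k ·ₚ p = map (λ { (a , β) → (k * a , β) }) p

  component : ∀ {m} → ℕ → Pol m → Pol m
  component d p = filterᵇ (λ { (a , β) → isYes (deg β ≟ℕ d) }) p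
    where
      open import Relation.Nullary.Decidable using (isYes)

  IsHomog : ∀ {m} → ℕ → Pol m → Set ℓ
  IsHomog t p = ∀ α → ¬ (deg α ≡ t) → coeff p α ≈ 0#

  record IsHomogIdeal {m : ℕ} (I : Pol m → Set (c ⊔ ℓ)) : Set (c ⊔ ℓ) where
    field
      respects : ∀ {p q} → p ≈ₚ q → I p → I q
      has-0    : I 0ₚ
      closed-+ : ∀ {p q} → I p → I q → I (p +ₚ q)
      closed-* : ∀ r {p} → I p → I (r *ₚ p)
      homog    : ∀ d {p} → I p → I (component d p)

  lincomb : ∀ {m d} → Vec Carrier d → Vec (Pol m) d → Pol m
  lincomb V.[] V.[] = 0ₚ
  lincomb (k V.∷ ks) (b V.∷ bs) = (k ·ₚ b) +ₚ lincomb ks bs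

  -- dim_K (R/I)_t = d : there are d homogeneous elements of degree t whose
  -- classes form a K-basis of (R/I)_t = R_t / I_t
  HilbertFn≡ : ∀ {m} → (Pol m → Set (c ⊔ ℓ)) → ℕ → ℕ → Set (c ⊔ ℓ)
  HilbertFn≡ {m} I t d =
    Σ (Vec (Pol m) d) λ b →
      (∀ i → IsHomog t (V.lookup b i)) ×
      (∀ ks → I (lincomb ks b) → ∀ i → V.lookup ks i ≈ 0#) ×
      (∀ p → IsHomog t p → Σ (Vec Carrier d) λ ks → I (p +ₚ (-ₚ lincomb ks b)))

  -- v = (H(0),...,H(s)) is the h-vector of R/I for some m and some
  -- homogeneous ideal I of R = K[x_1..x_m] with dim R/I = 0:
  -- H(t) = v_t for t ≤ s, H(s) ≠ 0, and H(t) = 0 for t > s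
  -- (the latter is exactly Krull dimension zero for graded R/I).
  IsHVector : List ℕ → Set (lsuc (c ⊔ ℓ))
  IsHVector v =
    Σ ℕ λ m → Σ (Pol m → Set (c ⊔ ℓ)) λ I →
      IsHomogIdeal I ×
      (∀ (i : Fin (length v)) → HilbertFn≡ I (toℕ i) (L.lookup v i)) ×
      (∀ t → length v ≤ t → HilbertFn≡ I t 0) ×
      (Σ (List ℕ) λ w → Σ ℕ λ x → (v ≡ w ∷ʳ x) × (x ≢ 0))

-- for v = (1,t_1,...,t_s): condition "t_{s-1} > 1 or s = 1"
secondLastGt1 : List ℕ → Bool
secondLastGt1 (a ∷ b ∷ []) = 1 <ᵇ a
secondLastGt1 (a ∷ b ∷ c ∷ cs) = secondLastGt1 (b ∷ c ∷ cs)
secondLastGt1 _ = false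

canInc : List ℕ → Bool
canInc (_ ∷ _ ∷ []) = true
canInc (_ ∷ y ∷ z ∷ zs) = secondLastGt1 (y ∷ z ∷ zs)
canInc _ = false

incLast : List ℕ → List ℕ
incLast [] = []
incLast (x ∷ []) = suc x ∷ []
incLast (x ∷ y ∷ ys) = x ∷ incLast (y ∷ ys)

Cstep : List (List ℕ) → List (List ℕ)
Cstep bs = map (λ v → v ∷ʳ 1) bs

Dstep : List (List ℕ) → List (List ℕ)
Dstep bs = map incLast (filterᵇ canInc bs)

B : ℕ → List (List ℕ)
B zero = []
B (suc zero) = (1 ∷ []) ∷ []
B (suc (suc zero)) = (1 ∷ 1 ∷ []) ∷ []
B (suc (suc (suc k))) = Cstep (B (suc (suc k))) ++ Dstep (B (suc (suc k)))

fib : ℕ → ℕ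
fib zero = 0
fib (suc zero) = 1
fib (suc (suc n)) = fib (suc n) +ℕ fib n

{-# OPTIONS --safe #-}
-- An h-vector (h₀, …, h_s) of R/I starts with h₀ = 1 because R₀ = K·1, and has no zero entry
-- before its last, nonzero one, because I ⊇ R_t forces I ⊇ x_j R_t = R_{t+1}.  After its first 1
-- in positive degree it stays 1: if R_{t+1} ≡ K·f modulo I and some monomial x_j ρ ≡ c·f with
-- c ≠ 0, then x_k f ≡ c⁻¹ x_j (x_k ρ) ∈ K·x_j f for every k, so R_{t+2} ≡ K·x_j f.  Hence every
-- h-vector is (1, b₁, …, b_r, 1, …, 1) with all b_i ≥ 2.  Each such vector arises in the
-- recursion for B(n): every b_i is grown by appending a 1 (the C-step) and incrementing it (the
-- D-step, allowed since the entry before it is ≥ 2 or the leading 1), and then the trailing ones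
-- are appended.  Finally |B(n+1)| = |B(n)| + |D(n+1)|, and the elements of B(n) admitting the
-- D-step are the C-images of D(n−1) together with D(n), which by induction number |B(n−1)|;
-- so |B(n)| = F_n.
module Submission where

open import Defs
open import Level using (Level; _⊔_)
open import Function using (_∘_)
open import Data.Empty using (⊥-elim)
open import Data.Unit.Polymorphic using (⊤; tt)
open import Data.Bool using (T; true; false)
open import Data.Sum using (inj₁; inj₂)
open import Data.Product using (Σ; ∃₂; _×_; _,_; proj₁; proj₂)
open import Data.Nat as ℕ using (ℕ; zero; suc; _≤_; z≤n; s≤s; _<ᵇ_) renaming (_≟_ to _≟ℕ_)
import Data.Nat.Properties as ℕ
open import Data.Nat.ListAction using (sum)
open import Data.Nat.ListAction.Properties using (sum-++)
open import Data.Fin using (Fin; zero; suc; toℕ)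
open import Data.Vec as Vec using (Vec; []; _∷_; toList)
import Data.Vec.Properties as Vec
open import Data.List as List using (List; []; _∷_; _++_; _∷ʳ_; length; filterᵇ)
import Data.List.Properties as List
open import Data.List.Reverse using (Reverse; []; _∶_∶ʳ_; reverseView)
open import Data.List.Membership.Propositional using (_∈_)
open import Data.List.Membership.Propositional.Properties
  using (∈-++⁺ˡ; ∈-++⁺ʳ; ∈-++⁻; ∈-∃++; ∈-map⁺; ∈-filter⁺)
open import Data.List.Relation.Unary.Any using (here; there)
open import Data.List.Relation.Unary.All as All using (All; []; _∷_)
import Data.List.Relation.Unary.All.Properties as All
open import Data.List.Relation.Unary.AllPairs using ([]; _∷_)
open import Data.List.Relation.Unary.Unique.Propositional using (Unique)
open import Relation.Nullary using (¬_; yes; no)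
open import Relation.Nullary.Decidable using (T?)
open import Relation.Binary.PropositionalEquality as ≡ using (_≡_; _≢_; refl; cong; cong₂)
open import Algebra.Properties.CommutativeSemigroup ℕ.+-commutativeSemigroup using (x∙yz≈y∙xz)

infixl 6 _⊕_
_⊕_ : ∀ {m} → Vec ℕ m → Vec ℕ m → Vec ℕ m
_⊕_ = Vec.zipWith ℕ._+_

unit : ∀ {m} → Fin m → Vec ℕ m
unit zero    = 1 ∷ Vec.replicate _ 0
unit (suc j) = 0 ∷ unit j

⊕-identityˡ : ∀ {m} (β : Vec ℕ m) → Vec.replicate m 0 ⊕ β ≡ β
⊕-identityˡ = Vec.zipWith-identityˡ ℕ.+-identityˡ

⊕-leftComm : ∀ {m} (α β γ : Vec ℕ m) → α ⊕ (β ⊕ γ) ≡ β ⊕ (α ⊕ γ)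
⊕-leftComm []      []      []      = refl
⊕-leftComm (a ∷ α) (b ∷ β) (c ∷ γ) = cong₂ _∷_ (x∙yz≈y∙xz a b c) (⊕-leftComm α β γ)

sum-unit⊕ : ∀ {m} (j : Fin m) (ρ : Vec ℕ m) → sum (toList (unit j ⊕ ρ)) ≡ suc (sum (toList ρ))
sum-unit⊕ zero    (r ∷ ρ) = cong (λ σ → suc (r ℕ.+ sum (toList σ))) (⊕-identityˡ ρ)
sum-unit⊕ (suc j) (r ∷ ρ) = ≡.trans (cong (r ℕ.+_) (sum-unit⊕ j ρ)) (ℕ.+-suc r _)

sum≡suc⇒unit⊕ : ∀ {m t} (β : Vec ℕ m) → sum (toList β) ≡ suc t →
                ∃₂ λ j ρ → β ≡ unit j ⊕ ρ × sum (toList ρ) ≡ t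
sum≡suc⇒unit⊕ (zero  ∷ β) eq with j , ρ , refl , ρ-sum ← sum≡suc⇒unit⊕ β eq = suc j , 0 ∷ ρ , refl , ρ-sum
sum≡suc⇒unit⊕ (suc b ∷ β) eq = zero , b ∷ β , cong (suc b ∷_) (≡.sym (⊕-identityˡ β)) , ℕ.suc-injective eq

sum≡0⇒replicate0 : ∀ {m} (β : Vec ℕ m) → sum (toList β) ≡ 0 → β ≡ Vec.replicate m 0
sum≡0⇒replicate0 []          _  = refl
sum≡0⇒replicate0 (zero  ∷ β) eq = cong (0 ∷_) (sum≡0⇒replicate0 β eq)

module _ {c ℓ : Level} (K : Field c ℓ) where
  open Field K hiding (zero) renaming (refl to ≈-refl; sym to ≈-sym; trans to ≈-trans)
  open Poly K
  open import Algebra.Properties.Ring ring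
    using (-0#≈0#; -‿+-comm; -1*x≈-x; ⁻¹-anti-homo‿-; x[y-z]≈xy-xz; -‿distribˡ-*; -‿involutive)
  open import Relation.Binary.Reasoning.Setoid setoid

  monomial : ∀ {m} → Monomial m → Pol m
  monomial β = (1# , β) ∷ []

  shift : ∀ {m} → Monomial m → Pol m → Pol m
  shift α = List.map (λ (a , β) → (a , α ⊕ β))

  coeff-∷-cong : ∀ {m a a'} (β : Monomial m) {p p' : Pol m} {α} →
                 a ≈ a' → coeff p α ≈ coeff p' α → coeff ((a , β) ∷ p) α ≈ coeff ((a' , β) ∷ p') α
  coeff-∷-cong β {α = α} a≈a' p≈p' with Vec.≡-dec _≟ℕ_ β α
  ... | yes _ = +-cong a≈a' p≈p'
  ... | no  _ = p≈p'

  coeff-∷-≢ : ∀ {m a} (β : Monomial m) (p : Pol m) {α} → β ≢ α → coeff ((a , β) ∷ p) α ≡ coeff p α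
  coeff-∷-≢ β p {α} β≢α with Vec.≡-dec _≟ℕ_ β α
  ... | yes β≡α = ⊥-elim (β≢α β≡α)
  ... | no  _   = refl

  coeff-+ₚ : ∀ {m} (p q : Pol m) α → coeff (p +ₚ q) α ≈ coeff p α + coeff q α
  coeff-+ₚ []            q α = ≈-sym (+-identityˡ _)
  coeff-+ₚ ((a , β) ∷ p) q α with Vec.≡-dec _≟ℕ_ β α
  ... | yes _ = ≈-trans (+-congˡ (coeff-+ₚ p q α)) (≈-sym (+-assoc _ _ _))
  ... | no  _ = coeff-+ₚ p q α

  coeff--ₚ : ∀ {m} (p : Pol m) α → coeff (-ₚ p) α ≈ - coeff p α
  coeff--ₚ []            α = ≈-sym -0#≈0#
  coeff--ₚ ((a , β) ∷ p) α with Vec.≡-dec _≟ℕ_ β α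
  ... | yes _ = ≈-trans (+-congˡ (coeff--ₚ p α)) (-‿+-comm _ _)
  ... | no  _ = coeff--ₚ p α

  coeff-·ₚ : ∀ {m} k (p : Pol m) α → coeff (k ·ₚ p) α ≈ k * coeff p α
  coeff-·ₚ k []            α = ≈-sym (zeroʳ k)
  coeff-·ₚ k ((a , β) ∷ p) α with Vec.≡-dec _≟ℕ_ β α
  ... | yes _ = ≈-trans (+-congˡ (coeff-·ₚ k p α)) (≈-sym (distribˡ k _ _))
  ... | no  _ = coeff-·ₚ k p α

  coeff-difference : ∀ {m} (p q : Pol m) α → coeff (p +ₚ (-ₚ q)) α ≈ coeff p α - coeff q α
  coeff-difference p q α = ≈-trans (coeff-+ₚ p (-ₚ q) α) (+-congˡ (coeff--ₚ q α))

  ·ₚ-identityˡ : ∀ {m} (p : Pol m) → (1# ·ₚ p) ≈ₚ p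
  ·ₚ-identityˡ p α = ≈-trans (coeff-·ₚ 1# p α) (*-identityˡ _)

  ·ₚ-zeroˡ : ∀ {m k} (p : Pol m) → k ≈ 0# → (k ·ₚ p) ≈ₚ 0ₚ
  ·ₚ-zeroˡ {k = k} p k≈0 α = ≈-trans (coeff-·ₚ k p α) (≈-trans (*-congʳ k≈0) (zeroˡ _))

  ·ₚ-assoc : ∀ {m} k l (p : Pol m) → (k ·ₚ (l ·ₚ p)) ≈ₚ ((k * l) ·ₚ p)
  ·ₚ-assoc k l p α = begin
    coeff (k ·ₚ (l ·ₚ p)) α ≈⟨ coeff-·ₚ k (l ·ₚ p) α ⟩
    k * coeff (l ·ₚ p) α    ≈⟨ *-congˡ (coeff-·ₚ l p α) ⟩
    k * (l * coeff p α)     ≈⟨ *-assoc k l _ ⟨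
    (k * l) * coeff p α     ≈⟨ coeff-·ₚ (k * l) p α ⟨
    coeff ((k * l) ·ₚ p) α  ∎

  ·ₚ-distribʳ : ∀ {m} k l (p : Pol m) → ((k ·ₚ p) +ₚ (l ·ₚ p)) ≈ₚ ((k + l) ·ₚ p)
  ·ₚ-distribʳ k l p α = begin
    coeff ((k ·ₚ p) +ₚ (l ·ₚ p)) α          ≈⟨ coeff-+ₚ (k ·ₚ p) (l ·ₚ p) α ⟩
    coeff (k ·ₚ p) α + coeff (l ·ₚ p) α     ≈⟨ +-cong (coeff-·ₚ k p α) (coeff-·ₚ l p α) ⟩
    k * coeff p α + l * coeff p α           ≈⟨ distribʳ _ k l ⟨
    (k + l) * coeff p α                     ≈⟨ coeff-·ₚ (k + l) p α ⟨
    coeff ((k + l) ·ₚ p) α                  ∎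

  lincomb-replicate0 : ∀ {m d} (bs : Vec (Pol m) d) → lincomb (Vec.replicate d 0#) bs ≈ₚ 0ₚ
  lincomb-replicate0 []       α = ≈-refl
  lincomb-replicate0 (b ∷ bs) α = begin
    coeff ((0# ·ₚ b) +ₚ lincomb (Vec.replicate _ 0#) bs) α
      ≈⟨ coeff-+ₚ (0# ·ₚ b) _ α ⟩
    coeff (0# ·ₚ b) α + coeff (lincomb (Vec.replicate _ 0#) bs) α
      ≈⟨ +-cong (·ₚ-zeroˡ b ≈-refl α) (lincomb-replicate0 bs α) ⟩
    0# + 0#
      ≈⟨ +-identityˡ 0# ⟩
    0#
      ∎

  constant*ₚ : ∀ {m} k (p : Pol m) → (((k , Vec.replicate m 0) ∷ []) *ₚ p) ≈ₚ (k ·ₚ p)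
  constant*ₚ k []            α = ≈-refl
  constant*ₚ k ((a , β) ∷ p) α rewrite ⊕-identityˡ β = coeff-∷-cong β ≈-refl (constant*ₚ k p α)

  monomial*ₚ : ∀ {m} (α : Monomial m) (p : Pol m) → (monomial α *ₚ p) ≈ₚ shift α p
  monomial*ₚ α []            γ = ≈-refl
  monomial*ₚ α ((a , β) ∷ p) γ = coeff-∷-cong (α ⊕ β) (*-identityˡ a) (monomial*ₚ α p γ)

  shift--ₚ : ∀ {m} (α : Monomial m) (p : Pol m) → shift α (-ₚ p) ≡ -ₚ shift α p
  shift--ₚ α []      = refl
  shift--ₚ α (_ ∷ p) = cong (_ ∷_) (shift--ₚ α p)

  shift-·ₚ : ∀ {m} (α : Monomial m) k (p : Pol m) → shift α (k ·ₚ p) ≡ k ·ₚ shift α p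
  shift-·ₚ α k []      = refl
  shift-·ₚ α k (_ ∷ p) = cong (_ ∷_) (shift-·ₚ α k p)

  coeff-component-≡ : ∀ {m t} (p : Pol m) {α} → deg α ≡ t → coeff (component t p) α ≈ coeff p α
  coeff-component-≡ []            _   = ≈-refl
  coeff-component-≡ {t = t} ((a , β) ∷ p) {α} α∈t with deg β ≟ℕ t
  ... | yes _   = coeff-∷-cong β ≈-refl (coeff-component-≡ p α∈t)
  ... | no  β∉t = ≈-trans (coeff-component-≡ p α∈t) (reflexive (≡.sym (coeff-∷-≢ β p β≢α)))
    where
    β≢α : β ≢ α
    β≢α β≡α = β∉t (≡.trans (cong deg β≡α) α∈t)

  coeff-component-≢ : ∀ {m t} (p : Pol m) {α} → deg α ≢ t → coeff (component t p) α ≈ 0#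
  coeff-component-≢ []            _   = ≈-refl
  coeff-component-≢ {t = t} ((a , β) ∷ p) {α} α∉t with deg β ≟ℕ t
  ... | no  _   = coeff-component-≢ p α∉t
  ... | yes β∈t = ≈-trans (reflexive (coeff-∷-≢ β (component t p) β≢α)) (coeff-component-≢ p α∉t)
    where
    β≢α : β ≢ α
    β≢α β≡α = α∉t (≡.trans (cong deg (≡.sym β≡α)) β∈t)

  component-homogeneous : ∀ {m t} (p : Pol m) → IsHomog t p → component t p ≈ₚ p
  component-homogeneous {t = t} p p∈t α with deg α ≟ℕ t
  ... | yes α∈t = coeff-component-≡ p α∈t
  ... | no  α∉t = ≈-trans (coeff-component-≢ p α∉t) (≈-sym (p∈t α α∉t))

  record IsSubspace {m q} (Q : Pol m → Set q) : Set (c ⊔ ℓ ⊔ q) where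
    field
      ≈ₚ-resp   : ∀ {p p'} → p ≈ₚ p' → Q p → Q p'
      0ₚ∈       : Q 0ₚ
      +ₚ-closed : ∀ {p p'} → Q p → Q p' → Q (p +ₚ p')
      ·ₚ-closed : ∀ k {p} → Q p → Q (k ·ₚ p)

  homogeneous-induction : ∀ {m q t} {Q : Pol m → Set q} → IsSubspace Q →
                          (∀ β → deg β ≡ t → Q (monomial β)) → ∀ p → IsHomog t p → Q p
  homogeneous-induction {t = t} {Q} subspace Q-monomial p p∈t =
    ≈ₚ-resp (component-homogeneous p p∈t) (Q-component p)
    where
    open IsSubspace subspace
    Q-component : ∀ p → Q (component t p)
    Q-component []            = 0ₚ∈
    Q-component ((a , β) ∷ p) with deg β ≟ℕ t
    ... | yes β∈t = ≈ₚ-resp a·β+p≈aβ∷p (+ₚ-closed (·ₚ-closed a (Q-monomial β β∈t)) (Q-component p))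
      where
      a·β+p≈aβ∷p : ((a ·ₚ monomial β) +ₚ component t p) ≈ₚ ((a , β) ∷ component t p)
      a·β+p≈aβ∷p α = coeff-∷-cong β {component t p} {component t p} {α} (*-identityʳ a) ≈-refl
    ... | no  _   = Q-component p

  ¬¬-subspace : ∀ {m q} {Q : Pol m → Set q} → IsSubspace Q → IsSubspace (λ p → ¬ ¬ Q p)
  ¬¬-subspace subspace = record
    { ≈ₚ-resp   = λ p≈p' ¬¬Qp ¬Qp' → ¬¬Qp (¬Qp' ∘ ≈ₚ-resp p≈p')
    ; 0ₚ∈       = λ ¬Q0 → ¬Q0 0ₚ∈
    ; +ₚ-closed = λ ¬¬Qp ¬¬Qp' ¬Qsum → ¬¬Qp (λ Qp → ¬¬Qp' (¬Qsum ∘ +ₚ-closed Qp))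
    ; ·ₚ-closed = λ k ¬¬Qp ¬Qkp → ¬¬Qp (¬Qkp ∘ ·ₚ-closed k)
    }
    where open IsSubspace subspace

  monomial-homogeneous : ∀ {m t} (β : Monomial m) → deg β ≡ t → IsHomog t (monomial β)
  monomial-homogeneous β β∈t α α∉t =
    reflexive (coeff-∷-≢ β [] (λ β≡α → α∉t (≡.trans (cong deg (≡.sym β≡α)) β∈t)))

  module Quotient {m} {I : Pol m → Set (c ⊔ ℓ)} (isHomogIdeal : IsHomogIdeal I) where
    open IsHomogIdeal isHomogIdeal

    ·ₚ-closed : ∀ k {p} → I p → I (k ·ₚ p)
    ·ₚ-closed k {p} p∈I = respects (constant*ₚ k p) (closed-* ((k , Vec.replicate m 0) ∷ []) p∈I)

    shift-closed : ∀ α {p} → I p → I (shift α p)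
    shift-closed α {p} p∈I = respects (monomial*ₚ α p) (closed-* (monomial α) p∈I)

    I-subspace : IsSubspace I
    I-subspace = record { ≈ₚ-resp = respects ; 0ₚ∈ = has-0 ; +ₚ-closed = closed-+ ; ·ₚ-closed = ·ₚ-closed }

    -- Congruence modulo I; a record so that p and q can be inferred from a proof.
    infix 4 _≋_
    record _≋_ (p q : Pol m) : Set (c ⊔ ℓ) where
      constructor mk≋
      field difference∈I : I (p +ₚ (-ₚ q))

    ≈ₚ⇒≋ : ∀ {p q} → p ≈ₚ q → p ≋ q
    ≈ₚ⇒≋ {p} {q} p≈q = mk≋ (respects (λ α → begin
      0#                        ≈⟨ -‿inverseʳ (coeff q α) ⟨
      coeff q α - coeff q α     ≈⟨ +-congʳ (p≈q α) ⟨
      coeff p α - coeff q α     ≈⟨ coeff-difference p q α ⟨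
      coeff (p +ₚ (-ₚ q)) α     ∎) has-0)

    ≋-sym : ∀ {p q} → p ≋ q → q ≋ p
    ≋-sym {p} {q} (mk≋ p-q∈I) = mk≋ (respects (λ α → begin
      coeff ((- 1#) ·ₚ (p +ₚ (-ₚ q))) α    ≈⟨ coeff-·ₚ (- 1#) (p +ₚ (-ₚ q)) α ⟩
      - 1# * coeff (p +ₚ (-ₚ q)) α         ≈⟨ -1*x≈-x _ ⟩
      - coeff (p +ₚ (-ₚ q)) α              ≈⟨ -‿cong (coeff-difference p q α) ⟩
      - (coeff p α - coeff q α)            ≈⟨ ⁻¹-anti-homo‿- _ _ ⟩
      coeff q α - coeff p α                ≈⟨ coeff-difference q p α ⟨
      coeff (q +ₚ (-ₚ p)) α                ∎) (·ₚ-closed (- 1#) p-q∈I))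

    ≋-trans : ∀ {p q r} → p ≋ q → q ≋ r → p ≋ r
    ≋-trans {p} {q} {r} (mk≋ p-q∈I) (mk≋ q-r∈I) = mk≋ (respects (λ α → begin
      coeff ((p +ₚ (-ₚ q)) +ₚ (q +ₚ (-ₚ r))) α
        ≈⟨ coeff-+ₚ (p +ₚ (-ₚ q)) _ α ⟩
      coeff (p +ₚ (-ₚ q)) α + coeff (q +ₚ (-ₚ r)) α
        ≈⟨ +-cong (coeff-difference p q α) (coeff-difference q r α) ⟩
      (coeff p α - coeff q α) + (coeff q α - coeff r α)
        ≈⟨ telescope _ _ _ ⟩
      coeff p α - coeff r α
        ≈⟨ coeff-difference p r α ⟨
      coeff (p +ₚ (-ₚ r)) α
        ∎) (closed-+ p-q∈I q-r∈I))
      where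
      telescope : ∀ a b c → (a - b) + (b - c) ≈ a - c
      telescope a b c = begin
        (a - b) + (b - c)     ≈⟨ +-assoc a (- b) (b - c) ⟩
        a + (- b + (b - c))   ≈⟨ +-congˡ (+-assoc (- b) b (- c)) ⟨
        a + ((- b + b) - c)   ≈⟨ +-congˡ (+-congʳ (-‿inverseˡ b)) ⟩
        a + (0# - c)          ≈⟨ +-congˡ (+-identityˡ (- c)) ⟩
        a - c                 ∎

    +ₚ-cong : ∀ {p p' q q'} → p ≋ p' → q ≋ q' → (p +ₚ q) ≋ (p' +ₚ q')
    +ₚ-cong {p} {p'} {q} {q'} (mk≋ p-p'∈I) (mk≋ q-q'∈I) = mk≋ (respects (λ α → begin
      coeff ((p +ₚ (-ₚ p')) +ₚ (q +ₚ (-ₚ q'))) α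
        ≈⟨ coeff-+ₚ (p +ₚ (-ₚ p')) _ α ⟩
      coeff (p +ₚ (-ₚ p')) α + coeff (q +ₚ (-ₚ q')) α
        ≈⟨ +-cong (coeff-difference p p' α) (coeff-difference q q' α) ⟩
      (coeff p α - coeff p' α) + (coeff q α - coeff q' α)
        ≈⟨ interchange _ _ _ _ ⟩
      (coeff p α + coeff q α) + (- coeff p' α - coeff q' α)
        ≈⟨ +-congˡ (-‿+-comm _ _) ⟩
      (coeff p α + coeff q α) - (coeff p' α + coeff q' α)
        ≈⟨ +-cong (coeff-+ₚ p q α) (-‿cong (coeff-+ₚ p' q' α)) ⟨
      coeff (p +ₚ q) α - coeff (p' +ₚ q') α
        ≈⟨ coeff-difference (p +ₚ q) (p' +ₚ q') α ⟨
      coeff ((p +ₚ q) +ₚ (-ₚ (p' +ₚ q'))) α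
        ∎) (closed-+ p-p'∈I q-q'∈I))
      where open import Algebra.Properties.CommutativeSemigroup +-commutativeSemigroup using (interchange)

    ·ₚ-cong : ∀ k {p q} → p ≋ q → (k ·ₚ p) ≋ (k ·ₚ q)
    ·ₚ-cong k {p} {q} (mk≋ p-q∈I) = mk≋ (respects (λ α → begin
      coeff (k ·ₚ (p +ₚ (-ₚ q))) α                 ≈⟨ coeff-·ₚ k (p +ₚ (-ₚ q)) α ⟩
      k * coeff (p +ₚ (-ₚ q)) α                    ≈⟨ *-congˡ (coeff-difference p q α) ⟩
      k * (coeff p α - coeff q α)                  ≈⟨ x[y-z]≈xy-xz k _ _ ⟩
      k * coeff p α - k * coeff q α                ≈⟨ +-cong (coeff-·ₚ k p α) (-‿cong (coeff-·ₚ k q α)) ⟨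
      coeff (k ·ₚ p) α - coeff (k ·ₚ q) α          ≈⟨ coeff-difference (k ·ₚ p) (k ·ₚ q) α ⟨
      coeff ((k ·ₚ p) +ₚ (-ₚ (k ·ₚ q))) α          ∎) (·ₚ-closed k p-q∈I))

    shift-cong : ∀ α {p q} → p ≋ q → shift α p ≋ shift α q
    shift-cong α {p} {q} (mk≋ p-q∈I) = mk≋ (≡.subst I shift-difference (shift-closed α p-q∈I))
      where
      shift-difference : shift α (p +ₚ (-ₚ q)) ≡ shift α p +ₚ (-ₚ shift α q)
      shift-difference = ≡.trans (List.map-++ _ p (-ₚ q)) (cong (shift α p +ₚ_) (shift--ₚ α q))

    ≋0ₚ⇒∈I : ∀ {p} → p ≋ 0ₚ → I p
    ≋0ₚ⇒∈I {p} (mk≋ p-0∈I) = ≡.subst I (List.++-identityʳ p) p-0∈I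

    infix 4 _∈K·_
    _∈K·_ : Pol m → Pol m → Set (c ⊔ ℓ)
    p ∈K· g = Σ Carrier λ k → p ≋ (k ·ₚ g)

    ∈K·-subspace : ∀ g → IsSubspace (_∈K· g)
    ∈K·-subspace g = record
      { ≈ₚ-resp   = λ p≈p' (k , p≋kg) → k , ≋-trans (≋-sym (≈ₚ⇒≋ p≈p')) p≋kg
      ; 0ₚ∈       = 0# , ≋-sym (≈ₚ⇒≋ (·ₚ-zeroˡ g ≈-refl))
      ; +ₚ-closed = λ (k , p≋kg) (l , q≋lg) → k + l , ≋-trans (+ₚ-cong p≋kg q≋lg) (≈ₚ⇒≋ (·ₚ-distribʳ k l g))
      ; ·ₚ-closed = λ u (k , p≋kg) → u * k , ≋-trans (·ₚ-cong u p≋kg) (≈ₚ⇒≋ (·ₚ-assoc u k g))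
      }

    ∈K·-refl : ∀ g → g ∈K· g
    ∈K·-refl g = 1# , ≋-sym (≈ₚ⇒≋ (·ₚ-identityˡ g))

    ≋-∈K· : ∀ {p q g} → p ≋ q → q ∈K· g → p ∈K· g
    ≋-∈K· p≋q (k , q≋kg) = k , ≋-trans p≋q q≋kg

    ∈K·-trans : ∀ {p q g} → p ∈K· q → q ∈K· g → p ∈K· g
    ∈K·-trans {g = g} (k , p≋kq) q∈Kg = ≋-∈K· p≋kq (IsSubspace.·ₚ-closed (∈K·-subspace g) k q∈Kg)

    ∈K·-shift : ∀ α {p g} → p ∈K· g → shift α p ∈K· shift α g
    ∈K·-shift α {p} {g} (k , p≋kg) = k , ≡.subst (shift α p ≋_) (shift-·ₚ α k g) (shift-cong α p≋kg)

    ∈K·-cancel : ∀ {k p g} → ¬ k ≈ 0# → (k ·ₚ p) ∈K· g → p ∈K· g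
    ∈K·-cancel {k} {p} {g} k≉0 kp∈Kg with u , ku≈1 ← inverse k k≉0 =
      ≋-∈K· (≈ₚ⇒≋ p≈u·kp) (IsSubspace.·ₚ-closed (∈K·-subspace g) u kp∈Kg)
      where
      p≈u·kp : p ≈ₚ (u ·ₚ (k ·ₚ p))
      p≈u·kp α = begin
        coeff p α                  ≈⟨ *-identityˡ _ ⟨
        1# * coeff p α             ≈⟨ *-congʳ (≈-trans (≈-sym ku≈1) (*-comm k u)) ⟩
        (u * k) * coeff p α        ≈⟨ coeff-·ₚ (u * k) p α ⟨
        coeff ((u * k) ·ₚ p) α     ≈⟨ ·ₚ-assoc u k p α ⟨
        coeff (u ·ₚ (k ·ₚ p)) α    ∎

    Independent : ∀ {d} → Vec (Pol m) d → Set (c ⊔ ℓ)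
    Independent bs = ∀ ks → I (lincomb ks bs) → ∀ i → Vec.lookup ks i ≈ 0#

    independent⇒head∉I : ∀ {d b} {bs : Vec (Pol m) d} → Independent (b ∷ bs) → ¬ I b
    independent⇒head∉I {b = b} {bs} independent b∈I =
      0≉1 (≈-sym (independent (1# ∷ Vec.replicate _ 0#) b+0∈I zero))
      where
      b+0∈I : I ((1# ·ₚ b) +ₚ lincomb (Vec.replicate _ 0#) bs)
      b+0∈I = closed-+ (·ₚ-closed 1# b∈I) (≋0ₚ⇒∈I (≈ₚ⇒≋ (lincomb-replicate0 bs)))

    independent⇒¬collinear : ∀ {d b₀ b₁ g} {bs : Vec (Pol m) d} →
                             Independent (b₀ ∷ b₁ ∷ bs) → b₀ ∈K· g → ¬ b₁ ∈K· g
    independent⇒¬collinear {b₀ = b₀} {b₁} {g} {bs} independent (l₀ , b₀≋l₀g) (l₁ , b₁≋l₁g) =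
      independent⇒head∉I independent (≋0ₚ⇒∈I (≋-trans b₀≋l₀g (≈ₚ⇒≋ (·ₚ-zeroˡ g l₀≈0))))
      where
      cancel : ((l₁ ·ₚ (l₀ ·ₚ g)) +ₚ (((- l₀) ·ₚ (l₁ ·ₚ g)) +ₚ 0ₚ)) ≈ₚ 0ₚ
      cancel α = begin
        coeff ((l₁ ·ₚ (l₀ ·ₚ g)) +ₚ (((- l₀) ·ₚ (l₁ ·ₚ g)) +ₚ 0ₚ)) α
          ≈⟨ coeff-+ₚ (l₁ ·ₚ (l₀ ·ₚ g)) _ α ⟩
        coeff (l₁ ·ₚ (l₀ ·ₚ g)) α + coeff (((- l₀) ·ₚ (l₁ ·ₚ g)) +ₚ 0ₚ) α
          ≈⟨ +-cong (·ₚ-assoc l₁ l₀ g α) (≈-trans (coeff-+ₚ ((- l₀) ·ₚ (l₁ ·ₚ g)) 0ₚ α) (+-identityʳ _)) ⟩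
        coeff ((l₁ * l₀) ·ₚ g) α + coeff ((- l₀) ·ₚ (l₁ ·ₚ g)) α
          ≈⟨ +-cong (coeff-·ₚ (l₁ * l₀) g α) (≈-trans (·ₚ-assoc (- l₀) l₁ g α) (coeff-·ₚ (- l₀ * l₁) g α)) ⟩
        (l₁ * l₀) * coeff g α + (- l₀ * l₁) * coeff g α
          ≈⟨ distribʳ _ _ _ ⟨
        (l₁ * l₀ + - l₀ * l₁) * coeff g α
          ≈⟨ *-congʳ (+-cong (*-comm l₁ l₀) (≈-sym (-‿distribˡ-* l₀ l₁))) ⟩
        (l₀ * l₁ - l₀ * l₁) * coeff g α
          ≈⟨ *-congʳ (-‿inverseʳ _) ⟩
        0# * coeff g α
          ≈⟨ zeroˡ _ ⟩
        0#
          ∎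
      combination∈I : I (lincomb (l₁ ∷ - l₀ ∷ Vec.replicate _ 0#) (b₀ ∷ b₁ ∷ bs))
      combination∈I = ≋0ₚ⇒∈I (≋-trans
        (+ₚ-cong (·ₚ-cong l₁ b₀≋l₀g) (+ₚ-cong (·ₚ-cong (- l₀) b₁≋l₁g) (≈ₚ⇒≋ (lincomb-replicate0 bs))))
        (≈ₚ⇒≋ cancel))
      l₀≈0 : l₀ ≈ 0#
      l₀≈0 = begin
        l₀        ≈⟨ -‿involutive l₀ ⟨
        - (- l₀)  ≈⟨ -‿cong (independent (l₁ ∷ - l₀ ∷ Vec.replicate _ 0#) combination∈I (suc zero)) ⟩
        - 0#      ≈⟨ -0#≈0# ⟩
        0#        ∎

    R[_]⊆I : ℕ → Set (c ⊔ ℓ)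
    R[ t ]⊆I = ∀ p → IsHomog t p → I p

    R[]⊆I⇒H≢suc : ∀ {t d} → R[ t ]⊆I → ¬ HilbertFn≡ I t (suc d)
    R[]⊆I⇒H≢suc R[t]⊆I (b ∷ _ , homogeneous , independent , _) =
      independent⇒head∉I independent (R[t]⊆I b (homogeneous zero))

    H≡0⇒R[]⊆I : ∀ {t} → HilbertFn≡ I t 0 → R[ t ]⊆I
    H≡0⇒R[]⊆I ([] , _ , _ , spanning) p p∈R[t] with [] , p-0∈I ← spanning p p∈R[t] = ≋0ₚ⇒∈I (mk≋ p-0∈I)

    R[]⊆I-suc : ∀ {t} → R[ t ]⊆I → R[ suc t ]⊆I
    R[]⊆I-suc {t} R[t]⊆I = homogeneous-induction I-subspace monomial∈I
      where
      monomial∈I : ∀ β → deg β ≡ suc t → I (monomial β)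
      monomial∈I β β∈R[t+1] with j , ρ , refl , ρ∈R[t] ← sum≡suc⇒unit⊕ β β∈R[t+1] =
        shift-closed (unit j) (R[t]⊆I (monomial ρ) (monomial-homogeneous ρ ρ∈R[t]))

    spannedBy⇒H≢2+ : ∀ {t d g} → (∀ p → IsHomog t p → p ∈K· g) → ¬ HilbertFn≡ I t (2 ℕ.+ d)
    spannedBy⇒H≢2+ R[t]⊆Kg (b₀ ∷ b₁ ∷ _ , homogeneous , independent , _) =
      independent⇒¬collinear independent (R[t]⊆Kg b₀ (homogeneous zero))
                                         (R[t]⊆Kg b₁ (homogeneous (suc zero)))

    H₀≢2+ : ∀ {d} → ¬ HilbertFn≡ I 0 (2 ℕ.+ d)
    H₀≢2+ = spannedBy⇒H≢2+ (homogeneous-induction (∈K·-subspace (monomial (Vec.replicate m 0))) monomial∈K·1)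
      where
      monomial∈K·1 : ∀ β → deg β ≡ 0 → monomial β ∈K· monomial (Vec.replicate m 0)
      monomial∈K·1 β β∈R[0] rewrite sum≡0⇒replicate0 β β∈R[0] = ∈K·-refl _

    line-propagates : ∀ {t f j ρ c} → (∀ μ → deg μ ≡ suc t → monomial μ ∈K· f) →
                      deg ρ ≡ t → monomial (unit j ⊕ ρ) ≋ (c ·ₚ f) → ¬ c ≈ 0# →
                      ∀ p → IsHomog (2 ℕ.+ t) p → p ∈K· shift (unit j) f
    line-propagates {t} {f} {j} {ρ} {c} R[t+1]⊆Kf ρ∈R[t] xⱼρ≋cf c≉0 =
      homogeneous-induction (∈K·-subspace (shift (unit j) f)) monomial∈line
      where
      xₖf∈line : ∀ k → shift (unit k) f ∈K· shift (unit j) f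
      xₖf∈line k =
        ∈K·-cancel c≉0 (≋-∈K· c·xₖf≋xⱼxₖρ (∈K·-shift (unit j) (R[t+1]⊆Kf (unit k ⊕ ρ) xₖρ∈R[t+1])))
        where
        xₖρ∈R[t+1] : deg (unit k ⊕ ρ) ≡ suc t
        xₖρ∈R[t+1] = ≡.trans (sum-unit⊕ k ρ) (cong suc ρ∈R[t])
        c·xₖf≋xⱼxₖρ : (c ·ₚ shift (unit k) f) ≋ monomial (unit j ⊕ (unit k ⊕ ρ))
        c·xₖf≋xⱼxₖρ = ≡.subst₂ _≋_ (shift-·ₚ (unit k) c f) (cong monomial (⊕-leftComm (unit k) (unit j) ρ))
                        (≋-sym (shift-cong (unit k) xⱼρ≋cf))
      monomial∈line : ∀ β → deg β ≡ 2 ℕ.+ t → monomial β ∈K· shift (unit j) f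
      monomial∈line β β∈R[t+2] with k , μ , refl , μ∈R[t+1] ← sum≡suc⇒unit⊕ β β∈R[t+2] =
        ∈K·-trans (∈K·-shift (unit k) (R[t+1]⊆Kf μ μ∈R[t+1])) (xₖf∈line k)

    -- Equality in K is undecidable, so rather than choosing a monomial with a nonzero coefficient
    -- on f we prove ¬ ¬ f ∈ I: a monomial outside I has a nonzero coefficient, which would make
    -- the degree-(t + 2) part one-dimensional.
    H≡1⇒H≢2+ : ∀ {t d} → HilbertFn≡ I (suc t) 1 → ¬ HilbertFn≡ I (2 ℕ.+ t) (2 ℕ.+ d)
    H≡1⇒H≢2+ {t} (f ∷ [] , homogeneous , independent , spanning) H[t+2]≥2 =
      ¬¬f∈I (independent⇒head∉I independent)
      where
      R[t+1]⊆Kf : ∀ μ → deg μ ≡ suc t → monomial μ ∈K· f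
      R[t+1]⊆Kf μ μ∈R[t+1] with k ∷ [] , μ-kf∈I ← spanning (monomial μ) (monomial-homogeneous μ μ∈R[t+1]) =
        k , ≡.subst (monomial μ ≋_) (List.++-identityʳ (k ·ₚ f)) (mk≋ μ-kf∈I)
      ¬¬monomial∈I : ∀ μ → deg μ ≡ suc t → ¬ ¬ I (monomial μ)
      ¬¬monomial∈I μ μ∈R[t+1] μ∉I with j , ρ , refl , ρ∈R[t] ← sum≡suc⇒unit⊕ μ μ∈R[t+1] =
        spannedBy⇒H≢2+ (line-propagates R[t+1]⊆Kf ρ∈R[t] (proj₂ (R[t+1]⊆Kf _ μ∈R[t+1])) c≉0) H[t+2]≥2
        where
        c≉0 : ¬ proj₁ (R[t+1]⊆Kf _ μ∈R[t+1]) ≈ 0#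
        c≉0 c≈0 = μ∉I (≋0ₚ⇒∈I (≋-trans (proj₂ (R[t+1]⊆Kf _ μ∈R[t+1])) (≈ₚ⇒≋ (·ₚ-zeroˡ f c≈0))))
      ¬¬f∈I : ¬ ¬ I f
      ¬¬f∈I = homogeneous-induction (¬¬-subspace I-subspace) ¬¬monomial∈I f (homogeneous zero)

    HilbertFrom : ℕ → List ℕ → Set (c ⊔ ℓ)
    HilbertFrom t []       = ⊤
    HilbertFrom t (h ∷ hs) = HilbertFn≡ I t h × HilbertFrom (suc t) hs

    lookup⇒HilbertFrom : ∀ t hs → (∀ (i : Fin (length hs)) → HilbertFn≡ I (t ℕ.+ toℕ i) (List.lookup hs i)) →
                         HilbertFrom t hs
    lookup⇒HilbertFrom t []       _ = tt
    lookup⇒HilbertFrom t (h ∷ hs) H =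
      ≡.subst (λ s → HilbertFn≡ I s h) (ℕ.+-identityʳ t) (H zero) ,
      lookup⇒HilbertFrom (suc t) hs
        (λ i → ≡.subst (λ s → HilbertFn≡ I s (List.lookup hs i)) (ℕ.+-suc t (toℕ i)) (H (suc i)))

    R[]⊆I⇒HilbertFrom≡0 : ∀ {t} hs → R[ t ]⊆I → HilbertFrom t hs → All (_≡ 0) hs
    R[]⊆I⇒HilbertFrom≡0 []           _       _        = []
    R[]⊆I⇒HilbertFrom≡0 (zero  ∷ hs) R[t]⊆I (_ , H)  = refl ∷ R[]⊆I⇒HilbertFrom≡0 hs (R[]⊆I-suc R[t]⊆I) H
    R[]⊆I⇒HilbertFrom≡0 (suc h ∷ hs) R[t]⊆I (Hₜ , _) = ⊥-elim (R[]⊆I⇒H≢suc R[t]⊆I Hₜ)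

    last≢0⇒positive : ∀ {t} w {x} → HilbertFrom t (w ∷ʳ x) → x ≢ 0 → All (1 ≤_) (w ∷ʳ x)
    last≢0⇒positive []          _        x≢0 = ℕ.n≢0⇒n>0 x≢0 ∷ []
    last≢0⇒positive (suc h ∷ w) (_ , H)  x≢0 = s≤s z≤n ∷ last≢0⇒positive w H x≢0
    last≢0⇒positive (zero  ∷ w) (Hₜ , H) x≢0 =
      ⊥-elim (x≢0 (proj₂ (All.∷ʳ⁻ (R[]⊆I⇒HilbertFrom≡0 (w ∷ʳ _) (R[]⊆I-suc (H≡0⇒R[]⊆I Hₜ)) H))))

    H≡1⇒ones : ∀ {t} hs → All (1 ≤_) hs → HilbertFrom (suc t) (1 ∷ hs) → hs ≡ List.replicate (length hs) 1
    H≡1⇒ones []                 _            _              = refl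
    H≡1⇒ones (suc zero    ∷ hs) (_ ∷ hs≥1)   (_ , H)        = cong (1 ∷_) (H≡1⇒ones hs hs≥1 H)
    H≡1⇒ones (suc (suc h) ∷ hs) _            (H₁ , H₂ , _)  = ⊥-elim (H≡1⇒H≢2+ H₁ H₂)

    positive⇒shape≥1 : ∀ {t} hs → All (1 ≤_) hs → HilbertFrom (suc t) hs →
                       ∃₂ λ bs k → All (2 ≤_) bs × hs ≡ bs ++ List.replicate k 1
    positive⇒shape≥1 []                 _          _       = [] , 0 , [] , refl
    positive⇒shape≥1 (suc zero    ∷ hs) (_ ∷ hs≥1) H       =
      [] , suc (length hs) , [] , cong (1 ∷_) (H≡1⇒ones hs hs≥1 H)
    positive⇒shape≥1 (suc (suc h) ∷ hs) (_ ∷ hs≥1) (_ , H)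
      with bs , k , bs≥2 , refl ← positive⇒shape≥1 hs hs≥1 H =
      suc (suc h) ∷ bs , k , s≤s (s≤s z≤n) ∷ bs≥2 , refl

    positive⇒shape : ∀ {h hs} → HilbertFrom 0 (h ∷ hs) → All (1 ≤_) (h ∷ hs) →
                     ∃₂ λ bs k → All (2 ≤_) bs × h ∷ hs ≡ 1 ∷ bs ++ List.replicate k 1
    positive⇒shape {zero}        _        (() ∷ _)
    positive⇒shape {suc (suc _)} (H₀ , _) _ = ⊥-elim (H₀≢2+ H₀)
    positive⇒shape {suc zero} {hs} (_ , H) (_ ∷ hs≥1)
      with bs , k , bs≥2 , refl ← positive⇒shape≥1 hs hs≥1 H =
      bs , k , bs≥2 , refl

    last≢0⇒shape : ∀ w {x} → HilbertFrom 0 (w ∷ʳ x) → x ≢ 0 →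
                   ∃₂ λ bs k → All (2 ≤_) bs × w ∷ʳ x ≡ 1 ∷ bs ++ List.replicate k 1
    last≢0⇒shape []      H x≢0 = positive⇒shape H (last≢0⇒positive [] H x≢0)
    last≢0⇒shape (h ∷ w) H x≢0 = positive⇒shape H (last≢0⇒positive (h ∷ w) H x≢0)

  IsHVector⇒shape : ∀ {v} → IsHVector v → ∃₂ λ bs k → All (2 ≤_) bs × v ≡ 1 ∷ bs ++ List.replicate k 1
  IsHVector⇒shape (_ , _ , isHomogIdeal , values , _ , w , x , refl , x≢0) =
    last≢0⇒shape w (lookup⇒HilbertFrom 0 (w ∷ʳ x) values) x≢0
    where open Quotient isHomogIdeal

-- Also for n = 0: B(2) = C(B(1)), as (1) admits no D-step.
B-suc : ∀ n → B (2 ℕ.+ n) ≡ Cstep (B (suc n)) ++ Dstep (B (suc n))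
B-suc zero    = refl
B-suc (suc n) = refl

∷ʳ1∈B : ∀ {n v} → v ∈ B n → v ∷ʳ 1 ∈ B (suc n)
∷ʳ1∈B {suc n} v∈B = ≡.subst (_ ∈_) (≡.sym (B-suc n)) (∈-++⁺ˡ (∈-map⁺ (_∷ʳ 1) v∈B))

incLast∈B : ∀ {n v} → v ∈ B n → T (canInc v) → incLast v ∈ B (suc n)
incLast∈B {suc n} v∈B canInc-v = ≡.subst (_ ∈_) (≡.sym (B-suc n))
  (∈-++⁺ʳ (Cstep (B (suc n))) (∈-map⁺ incLast (∈-filter⁺ (T? ∘ canInc) v∈B canInc-v)))

incLast-∷ʳ : ∀ w x → incLast (w ∷ʳ x) ≡ w ∷ʳ suc x
incLast-∷ʳ []          x = refl
incLast-∷ʳ (y ∷ [])    x = refl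
incLast-∷ʳ (y ∷ z ∷ w) x = cong (y ∷_) (incLast-∷ʳ (z ∷ w) x)

secondLastGt1-∷ʳ∷ʳ : ∀ w x a → secondLastGt1 (w ∷ʳ x ∷ʳ a) ≡ (1 <ᵇ x)
secondLastGt1-∷ʳ∷ʳ []      x a = refl
secondLastGt1-∷ʳ∷ʳ (y ∷ w) x a = ≡.trans (drop-head w) (secondLastGt1-∷ʳ∷ʳ w x a)
  where
  drop-head : ∀ w → secondLastGt1 (y ∷ w ∷ʳ x ∷ʳ a) ≡ secondLastGt1 (w ∷ʳ x ∷ʳ a)
  drop-head []          = refl
  drop-head (_ ∷ [])    = refl
  drop-head (_ ∷ _ ∷ _) = refl

canInc-∷ʳ∷ʳ : ∀ y w x a → canInc (y ∷ w ∷ʳ x ∷ʳ a) ≡ (1 <ᵇ x)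
canInc-∷ʳ∷ʳ y w x a = ≡.trans (drop-head w) (secondLastGt1-∷ʳ∷ʳ w x a)
  where
  drop-head : ∀ w → canInc (y ∷ w ∷ʳ x ∷ʳ a) ≡ secondLastGt1 (w ∷ʳ x ∷ʳ a)
  drop-head []          = refl
  drop-head (_ ∷ [])    = refl
  drop-head (_ ∷ _ ∷ _) = refl

sum-∷ʳ : ∀ xs x → sum (xs ∷ʳ x) ≡ sum xs ℕ.+ x
sum-∷ʳ xs x = ≡.trans (sum-++ xs (x ∷ [])) (cong (sum xs ℕ.+_) (ℕ.+-identityʳ x))

∷ʳ1∈B-sum : ∀ {v} → v ∈ B (sum v) → v ∷ʳ 1 ∈ B (sum (v ∷ʳ 1))
∷ʳ1∈B-sum {v} v∈B = ≡.subst (λ n → v ∷ʳ 1 ∈ B n) (≡.sym sum≡) (∷ʳ1∈B {sum v} v∈B)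
  where
  sum≡ : sum (v ∷ʳ 1) ≡ suc (sum v)
  sum≡ = ≡.trans (sum-∷ʳ v 1) (ℕ.+-comm (sum v) 1)

∷ʳsuc∈B-sum : ∀ {w a} → T (canInc (w ∷ʳ a)) →
              w ∷ʳ a ∈ B (sum (w ∷ʳ a)) → w ∷ʳ suc a ∈ B (sum (w ∷ʳ suc a))
∷ʳsuc∈B-sum {w} {a} canInc-wa wa∈B =
  ≡.subst₂ (λ v n → v ∈ B n) (incLast-∷ʳ w a) (≡.sym sum≡) (incLast∈B {sum (w ∷ʳ a)} wa∈B canInc-wa)
  where
  sum≡ : sum (w ∷ʳ suc a) ≡ suc (sum (w ∷ʳ a))
  sum≡ = ≡.trans (sum-∷ʳ w (suc a)) (≡.trans (ℕ.+-suc (sum w) a) (cong suc (≡.sym (sum-∷ʳ w a))))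

canInc-1∷ : ∀ {bs} → Reverse bs → All (2 ≤_) bs → ∀ a → T (canInc (1 ∷ bs ∷ʳ a))
canInc-1∷ []             _    a = _
canInc-1∷ (bs ∶ _ ∶ʳ b) bs≥2 a rewrite canInc-∷ʳ∷ʳ 1 bs b a = ℕ.<⇒<ᵇ (proj₂ (All.∷ʳ⁻ bs≥2))

1∷bs∈B : ∀ {bs} → Reverse bs → All (2 ≤_) bs → 1 ∷ bs ∈ B (sum (1 ∷ bs))
1∷bs∈B []              _    = here refl
1∷bs∈B (bs ∶ rbs ∶ʳ b) bs≥2 with bs'≥2 , s≤s (s≤s {n = a} _) ← All.∷ʳ⁻ bs≥2 = append (suc a)
  where
  append : ∀ a → 1 ∷ bs ∷ʳ suc a ∈ B (sum (1 ∷ bs ∷ʳ suc a))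
  append zero    = ∷ʳ1∈B-sum {1 ∷ bs} (1∷bs∈B rbs bs'≥2)
  append (suc a) = ∷ʳsuc∈B-sum {1 ∷ bs} (canInc-1∷ rbs bs'≥2 (suc a)) (append a)

replicate-suc : ∀ {A : Set} k (x : A) → List.replicate (suc k) x ≡ List.replicate k x ∷ʳ x
replicate-suc zero    x = refl
replicate-suc (suc k) x = cong (x ∷_) (replicate-suc k x)

shape∈B : ∀ {bs} → All (2 ≤_) bs → ∀ k →
          1 ∷ bs ++ List.replicate k 1 ∈ B (sum (1 ∷ bs ++ List.replicate k 1))
shape∈B {bs} bs≥2 zero    rewrite List.++-identityʳ bs = 1∷bs∈B (reverseView bs) bs≥2
shape∈B {bs} bs≥2 (suc k) rewrite replicate-suc k 1 | ≡.sym (List.++-assoc bs (List.replicate k 1) (1 ∷ [])) =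
  ∷ʳ1∈B-sum {1 ∷ bs ++ List.replicate k 1} (shape∈B bs≥2 k)

EndsPositive : List ℕ → Set
EndsPositive v = ∃₂ λ w x → v ≡ w ∷ʳ suc x

B-endsPositive : ∀ n → All EndsPositive (B (suc n))
B-endsPositive zero    = ([] , 0 , refl) ∷ []
B-endsPositive (suc n) = ≡.subst (All EndsPositive) (≡.sym (B-suc n))
  (All.++⁺ (All.map⁺ (All.tabulate (λ {v} _ → v , 0 , refl)))
           (All.map⁺ (All.map incLast-endsPositive (All.filter⁺ (T? ∘ canInc) (B-endsPositive n)))))
  where
  incLast-endsPositive : ∀ {v} → EndsPositive v → EndsPositive (incLast v)
  incLast-endsPositive (w , x , refl) = w , suc x , incLast-∷ʳ w (suc x)

canInc-∷ʳ1∷ʳ1 : ∀ {v} → EndsPositive v → canInc (v ∷ʳ 1 ∷ʳ 1) ≡ false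
canInc-∷ʳ1∷ʳ1 ([]    , x , refl) = refl
canInc-∷ʳ1∷ʳ1 (y ∷ w , x , refl) = canInc-∷ʳ∷ʳ y (w ∷ʳ suc x) 1 1

canInc-incLast∷ʳ1 : ∀ {v} → EndsPositive v → canInc (incLast v ∷ʳ 1) ≡ true
canInc-incLast∷ʳ1 (w , x , refl) rewrite incLast-∷ʳ w (suc x) = ends≥2 w
  where
  ends≥2 : ∀ w → canInc (w ∷ʳ suc (suc x) ∷ʳ 1) ≡ true
  ends≥2 []      = refl
  ends≥2 (y ∷ w) = canInc-∷ʳ∷ʳ y w (suc (suc x)) 1

secondLastGt1-incLast : ∀ y z zs → secondLastGt1 (y ∷ incLast (z ∷ zs)) ≡ secondLastGt1 (y ∷ z ∷ zs)
secondLastGt1-incLast y z []           = refl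
secondLastGt1-incLast y z (u ∷ [])     = refl
secondLastGt1-incLast y z (u ∷ w ∷ ws) = secondLastGt1-incLast z u (w ∷ ws)

canInc-incLast : ∀ v → canInc (incLast v) ≡ canInc v
canInc-incLast []                    = refl
canInc-incLast (x ∷ [])              = refl
canInc-incLast (x ∷ y ∷ [])          = refl
canInc-incLast (x ∷ y ∷ z ∷ [])      = refl
canInc-incLast (x ∷ y ∷ z ∷ u ∷ us)  = secondLastGt1-incLast y z (u ∷ us)

Dstep-canInc : ∀ vs → All (T ∘ canInc) (Dstep vs)
Dstep-canInc vs =
  All.map⁺ (All.map (λ {v} → ≡.subst T (≡.sym (canInc-incLast v))) (All.all-filter (T? ∘ canInc) vs))

filter-canInc-B : ∀ n → filterᵇ canInc (B (3 ℕ.+ n)) ≡ Cstep (Dstep (B (suc n))) ++ Dstep (B (2 ℕ.+ n))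
filter-canInc-B n = begin
  filterᵇ canInc (Cstep X ++ Dstep X)
    ≡⟨ List.filter-++ (T? ∘ canInc) (Cstep X) (Dstep X) ⟩
  filterᵇ canInc (Cstep X) ++ filterᵇ canInc (Dstep X)
    ≡⟨ cong₂ _++_ (cong (filterᵇ canInc ∘ Cstep) (B-suc n))
                  (List.filter-all (T? ∘ canInc) (Dstep-canInc X)) ⟩
  filterᵇ canInc (Cstep (Cstep Y ++ Dstep Y)) ++ Dstep X
    ≡⟨ cong (λ vs → filterᵇ canInc vs ++ Dstep X) (List.map-++ (_∷ʳ 1) (Cstep Y) (Dstep Y)) ⟩
  filterᵇ canInc (Cstep (Cstep Y) ++ Cstep (Dstep Y)) ++ Dstep X
    ≡⟨ cong (_++ Dstep X) (List.filter-++ (T? ∘ canInc) (Cstep (Cstep Y)) (Cstep (Dstep Y))) ⟩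
  (filterᵇ canInc (Cstep (Cstep Y)) ++ filterᵇ canInc (Cstep (Dstep Y))) ++ Dstep X
    ≡⟨ cong (λ vs → vs ++ Dstep X) (cong₂ _++_ (List.filter-none (T? ∘ canInc) CC-rejected)
                                               (List.filter-all (T? ∘ canInc) CD-accepted)) ⟩
  Cstep (Dstep Y) ++ Dstep X
    ∎
  where
  open ≡.≡-Reasoning
  Y = B (suc n)
  X = B (2 ℕ.+ n)
  CC-rejected : All (¬_ ∘ T ∘ canInc) (Cstep (Cstep Y))
  CC-rejected = All.map⁺ (All.map⁺ (All.map (λ ends → ≡.subst T (canInc-∷ʳ1∷ʳ1 ends)) (B-endsPositive n)))
  CD-accepted : All (T ∘ canInc) (Cstep (Dstep Y))
  CD-accepted = All.map⁺ (All.map⁺ (All.map (λ ends → ≡.subst T (≡.sym (canInc-incLast∷ʳ1 ends)) _)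
                                              (All.filter⁺ (T? ∘ canInc) (B-endsPositive n))))

length-B-suc : ∀ n → length (B (2 ℕ.+ n)) ≡ length (B (suc n)) ℕ.+ length (Dstep (B (suc n)))
length-B-suc n = begin
  length (B (2 ℕ.+ n))                      ≡⟨ cong length (B-suc n) ⟩
  length (Cstep Y ++ Dstep Y)               ≡⟨ List.length-++ (Cstep Y) ⟩
  length (Cstep Y) ℕ.+ length (Dstep Y)     ≡⟨ cong (ℕ._+ length (Dstep Y)) (List.length-map (_∷ʳ 1) Y) ⟩
  length Y ℕ.+ length (Dstep Y)             ∎
  where
  open ≡.≡-Reasoning
  Y = B (suc n)

length-Dstep-B : ∀ n → length (Dstep (B (2 ℕ.+ n))) ≡ length (B (suc n))
length-Dstep-B zero    = refl
length-Dstep-B (suc n) = begin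
  length (Dstep (B (3 ℕ.+ n)))
    ≡⟨ List.length-map incLast (filterᵇ canInc (B (3 ℕ.+ n))) ⟩
  length (filterᵇ canInc (B (3 ℕ.+ n)))
    ≡⟨ cong length (filter-canInc-B n) ⟩
  length (Cstep (Dstep Y) ++ Dstep X)
    ≡⟨ List.length-++ (Cstep (Dstep Y)) ⟩
  length (Cstep (Dstep Y)) ℕ.+ length (Dstep X)
    ≡⟨ cong₂ ℕ._+_ (List.length-map (_∷ʳ 1) (Dstep Y)) (length-Dstep-B n) ⟩
  length (Dstep Y) ℕ.+ length Y
    ≡⟨ ℕ.+-comm (length (Dstep Y)) (length Y) ⟩
  length Y ℕ.+ length (Dstep Y)
    ≡⟨ length-B-suc n ⟨
  length X
    ∎
  where
  open ≡.≡-Reasoning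
  Y = B (suc n)
  X = B (2 ℕ.+ n)

length-B : ∀ n → length (B (suc n)) ≡ fib (suc n)
length-B zero          = refl
length-B (suc zero)    = refl
length-B (suc (suc n)) = begin
  length (B (3 ℕ.+ n))                                   ≡⟨ length-B-suc (suc n) ⟩
  length (B (2 ℕ.+ n)) ℕ.+ length (Dstep (B (2 ℕ.+ n)))  ≡⟨ cong (length (B (2 ℕ.+ n)) ℕ.+_) (length-Dstep-B n) ⟩
  length (B (2 ℕ.+ n)) ℕ.+ length (B (suc n))            ≡⟨ cong₂ ℕ._+_ (length-B (suc n)) (length-B n) ⟩
  fib (2 ℕ.+ n) ℕ.+ fib (suc n)                          ∎
  where open ≡.≡-Reasoning

Unique⇒length≤ : ∀ {A : Set} {xs ys : List A} → Unique xs → All (_∈ ys) xs → length xs ≤ length ys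
Unique⇒length≤                  []             []             = z≤n
Unique⇒length≤ {xs = x ∷ xs} {ys} (x∉xs ∷ unique) (x∈ys ∷ xs⊆ys) with ys₁ , ys₂ , refl ← ∈-∃++ x∈ys =
  ≡.subst (suc (length xs) ≤_) (≡.sym (List.length-++-sucʳ ys₁ x ys₂))
    (s≤s (Unique⇒length≤ unique (All.zipWith remove-x (x∉xs , xs⊆ys))))
  where
  remove-x : ∀ {z} → x ≢ z × z ∈ ys₁ ++ x ∷ ys₂ → z ∈ ys₁ ++ ys₂
  remove-x (x≢z , z∈ys) with ∈-++⁻ ys₁ z∈ys
  ... | inj₁ z∈ys₁          = ∈-++⁺ˡ z∈ys₁
  ... | inj₂ (here z≡x)     = ⊥-elim (x≢z (≡.sym z≡x))
  ... | inj₂ (there z∈ys₂)  = ∈-++⁺ʳ ys₁ z∈ys₂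

hvector∈B : ∀ {c ℓ} (K : Field c ℓ) {v} → Poly.IsHVector K v → v ∈ B (sum v)
hvector∈B K v-hvec with bs , k , bs≥2 , refl ← IsHVector⇒shape K v-hvec = shape∈B bs≥2 k

theorem2p4 : ∀ {c ℓ : Level} (K : Field c ℓ) (n : ℕ) → 1 ≤ n →
    ((v : List ℕ) → Poly.IsHVector K v → sum v ≡ n → v ∈ B n)
    × ((hs : List (List ℕ)) → Unique hs → All (λ v → Poly.IsHVector K v × sum v ≡ n) hs → length hs ≤ fib n)
theorem2p4 K (suc n) _ = L⊆B , λ hs unique hs⊆L →
  ≡.subst (length hs ≤_) (length-B n)
    (Unique⇒length≤ unique (All.map (λ (v-hvec , v-sum) → L⊆B _ v-hvec v-sum) hs⊆L))
  where
  L⊆B : (v : List ℕ) → Poly.IsHVector K v → sum v ≡ suc n → v ∈ B (suc n)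
  L⊆B v v-hvec v-sum = ≡.subst (λ m → v ∈ B m) v-sum (hvector∈B K v-hvec)
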